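{- For every $n$, the mixed page number of the complete graph $K_n$ is at least $\lceil\frac{3(n-4)}{8}\rceil$.
   Context: Given a total vertex order $\prec$, two edges $(u_1,v_1)$, $(u_2,v_2)$ with four distinct endpoints and $u_1\prec v_1$, $u_2 \prec v_2$, $u_1 \prec u_2$ are said to cross if $u_1 \prec u_2 \prec v_1 \prec v_2$, and to nest if $u_1 \prec u_2 \prec v_2 \prec v_1$. A stack is a set of edges no two of which cross; a queue is a set of edges no two of which nest. The mixed page number of a graph $G$ is the minimum value of $s+q$ such that there is a total order of the vertices of $G$ and a partition of its edges into $s$ stacks and $q$ queues with respect to that order. -}

module Defs where

open import Data.Nat using (ℕ; _+_; _*_; _∸_; _<_; _≤_)
open import Data.Nat.DivMod using (_/_)
open import Data.Fin using (Fin; toℕ)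
open import Data.Product using (_×_; Σ; _,_)
open import Relation.Binary.PropositionalEquality using (_≡_; _≢_)
open import Function.Definitions using (Injective)
open import Data.Sum using (_⊎_)
open import Relation.Nullary using (¬_)

-- A total order on the vertex set Fin n, given by an injective
-- position map pos : Fin n → ℕ  (u ≺ v  iff  pos u < pos v).
record VertexOrder (n : ℕ) : Set where
  field
    pos    : Fin n → ℕ
    pos-inj : Injective _≡_ _≡_ pos

-- An (oriented) edge of K_n: u ≺ v in the order.
-- Edges of K_n are the unordered pairs {u,v}, u ≠ v; in an order each
-- is represented uniquely by the pair (u , v) with pos u < pos v.
Edge : {n : ℕ} → VertexOrder n → Set
Edge {n} o = Σ (Fin n × Fin n) λ { (u , v) → VertexOrder.pos o u < VertexOrder.pos o v }

module _ {n : ℕ} (o : VertexOrder n) where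
  open VertexOrder o

  -- (u1,v1),(u2,v2) cross: four distinct endpoints and
  -- u1 ≺ u2 ≺ v1 ≺ v2 or u2 ≺ u1 ≺ v2 ≺ v1
  -- (strict inequalities of positions imply distinctness).
  Cross : Edge o → Edge o → Set
  Cross ((u₁ , v₁) , _) ((u₂ , v₂) , _) =
      (pos u₁ < pos u₂ × pos u₂ < pos v₁ × pos v₁ < pos v₂)
    ⊎ (pos u₂ < pos u₁ × pos u₁ < pos v₂ × pos v₂ < pos v₁)

  Nest : Edge o → Edge o → Set
  Nest ((u₁ , v₁) , _) ((u₂ , v₂) , _) =
      (pos u₁ < pos u₂ × pos u₂ < pos v₂ × pos v₂ < pos v₁)
    ⊎ (pos u₂ < pos u₁ × pos u₁ < pos v₁ × pos v₁ < pos v₂)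

record MixedLayout (n s q : ℕ) : Set where
  field
    order : VertexOrder n
    page  : Edge order → Fin (s + q)
    stack-ok : ∀ e f → page e ≡ page f → toℕ (page e) < s → ¬ Cross order e f
    queue-ok : ∀ e f → page e ≡ page f → s ≤ toℕ (page e) → ¬ Nest order e f

-- ⌈ 3(n-4)/8 ⌉, taken as 0 when n ≤ 4 (the real value is then ≤ 0).
ceil3n-4/8 : ℕ → ℕ
ceil3n-4/8 n = (3 * (n ∸ 4) + 7) / 8

-- Identify the vertices with their ranks 0, …, n − 1 in the order and let m = ⌊n/2⌋.
-- Call a pair a < b admissible if a + 2 ≤ b < 2m and m < a + b ≤ 3m; there are at least
-- m(m − 1) + (m − 1)(m − 2)/2 of them. Every page carries at most 2m admissible edges.
-- On a queue page, two edges with the same sum a + b would nest, so sums are distinct, and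
-- they lie in (m, 3m]. On a stack page, an edge (a, b) with b ≥ a + 2 has a point a < y < b
-- lying under no other edge of the page spanned by [a, b] (the largest among a + 1 and the
-- right ends of page edges leaving a), and since no two edges cross, y determines the edge.
-- Hence 2m(s + q) ≥ m(m − 1) + (m − 1)(m − 2)/2, which gives s + q ≥ ⌈3(n − 4)/8⌉.
module Submission where

open import Data.Empty using (⊥; ⊥-elim)
open import Data.Fin as Fin using (Fin; zero; suc; toℕ; fromℕ<; splitAt)
import Data.Fin.Properties as Finₚ
open import Data.Nat
open import Data.Nat.DivMod using (m<n*o⇒m/o<n)
open import Data.Nat.Properties
open import Data.Nat.Tactic.RingSolver using (solve-∀)
open import Data.Product using (Σ; ∃; ∃-syntax; _×_; _,_; proj₁; proj₂; uncurry)
open import Data.Sum using (_⊎_; inj₁; inj₂; [_,_]′)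
open import Data.Vec.Functional using (Vector; []; _++_)
open import Data.Vec.Functional.Relation.Unary.All as All using (All)
open import Data.Vec.Functional.Relation.Unary.All.Properties using (++⁺)
open import Function using (_∘_)
open import Function.Bundles using (Injection)
open import Function.Definitions using (Injective)
open import Function.Properties.Inverse using (Inverse⇒Injection)
open import Level using (0ℓ)
open import Relation.Binary.Definitions using (tri<; tri≈; tri>)
open import Relation.Binary.PropositionalEquality
open import Relation.Nullary using (¬_; Dec; yes; no; contradiction)
open import Relation.Nullary.Decidable using (_⊎-dec_)
open import Relation.Unary using (Pred; Decidable; _⊆_)
open import Relation.Unary.Properties using (U?)

open import Defs

-- Ranks

count : ∀ {n} {P : Pred (Fin n) 0ℓ} → Decidable P → ℕ
count {zero}  P? = 0
count {suc n} P? with P? zero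
... | yes _ = suc (count (P? ∘ suc))
... | no  _ = count (P? ∘ suc)

count-mono : ∀ {n} {P Q : Pred (Fin n) 0ℓ} (P? : Decidable P) (Q? : Decidable Q) →
             P ⊆ Q → count P? ≤ count Q?
count-mono {zero}  P? Q? P⊆Q = z≤n
count-mono {suc n} P? Q? P⊆Q with P? zero | Q? zero
... | yes p | no ¬q = contradiction (P⊆Q p) ¬q
... | yes _ | yes _ = s≤s (count-mono (P? ∘ suc) (Q? ∘ suc) P⊆Q)
... | no  _ | yes _ = m≤n⇒m≤1+n (count-mono (P? ∘ suc) (Q? ∘ suc) P⊆Q)
... | no  _ | no  _ = count-mono (P? ∘ suc) (Q? ∘ suc) P⊆Q

count-< : ∀ {n} {P Q : Pred (Fin n) 0ℓ} (P? : Decidable P) (Q? : Decidable Q) →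
          P ⊆ Q → ∀ {i} → ¬ P i → Q i → count P? < count Q?
count-< {suc n} P? Q? P⊆Q {i} ¬Pi Qi with P? zero | Q? zero | i
... | yes p | no ¬q | _     = contradiction (P⊆Q p) ¬q
... | yes p | yes _ | zero  = contradiction p ¬Pi
... | no  _ | no ¬q | zero  = contradiction Qi ¬q
... | no  _ | yes _ | zero  = s≤s (count-mono (P? ∘ suc) (Q? ∘ suc) P⊆Q)
... | yes _ | yes _ | suc i = s≤s (count-< (P? ∘ suc) (Q? ∘ suc) P⊆Q ¬Pi Qi)
... | no  _ | yes _ | suc i = m<n⇒m<1+n (count-< (P? ∘ suc) (Q? ∘ suc) P⊆Q ¬Pi Qi)
... | no  _ | no  _ | suc i = count-< (P? ∘ suc) (Q? ∘ suc) P⊆Q ¬Pi Qi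

count-U : ∀ n → count {n} U? ≡ n
count-U zero    = refl
count-U (suc n) = cong suc (count-U n)

injective⇒surjective : ∀ {n} {f : Fin n → Fin n} → Injective _≡_ _≡_ f → ∀ i → ∃[ j ] f j ≡ i
injective⇒surjective {suc n} {f} f-inj i with Finₚ.any? (λ j → f j Finₚ.≟ i)
... | yes hit = hit
... | no miss = contradiction (Finₚ.injective⇒≤ punchOut∘f-injective) 1+n≰n
  where
  i≢f : ∀ j → i ≢ f j
  i≢f j i≡fj = miss (j , sym i≡fj)

  punchOut∘f-injective : Injective _≡_ _≡_ (λ j → Fin.punchOut (i≢f j))
  punchOut∘f-injective eq = f-inj (Finₚ.punchOut-injective (i≢f _) (i≢f _) eq)

module Ranks {n} (o : VertexOrder n) where
  open VertexOrder o

  before? : ∀ u → Decidable (λ w → pos w < pos u)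
  before? u w = pos w <? pos u

  rank : Fin n → ℕ
  rank u = count (before? u)

  rank-< : ∀ {u v} → pos u < pos v → rank u < rank v
  rank-< {u} {v} u<v = count-< (before? u) (before? v) (λ w<u → <-trans w<u u<v) (<-irrefl refl) u<v

  rank<n : ∀ u → rank u < n
  rank<n u = subst (rank u <_) (count-U n) (count-< (before? u) U? _ (<-irrefl refl) _)

  rank-<⁻¹ : ∀ {u v} → rank u < rank v → pos u < pos v
  rank-<⁻¹ {u} {v} r<r with <-cmp (pos u) (pos v)
  ... | tri< u<v _ _ = u<v
  ... | tri≈ _ u≈v _ = contradiction (cong rank (pos-inj u≈v)) (<⇒≢ r<r)
  ... | tri> _ _ v<u = contradiction (rank-< v<u) (<⇒≯ r<r)

  rank-injective : ∀ {u v} → rank u ≡ rank v → u ≡ v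
  rank-injective {u} {v} r≡r with <-cmp (pos u) (pos v)
  ... | tri< u<v _ _ = contradiction r≡r (<⇒≢ (rank-< u<v))
  ... | tri≈ _ u≈v _ = pos-inj u≈v
  ... | tri> _ _ v<u = contradiction (sym r≡r) (<⇒≢ (rank-< v<u))

  private
    rank-surjective : ∀ i → ∃[ u ] fromℕ< (rank<n u) ≡ i
    rank-surjective = injective⇒surjective (rank-injective ∘ Finₚ.fromℕ<-injective _ _ _ _)

  vertexAt : ∀ {i} → i < n → Fin n
  vertexAt i<n = proj₁ (rank-surjective (fromℕ< i<n))

  rank-vertexAt : ∀ {i} (i<n : i < n) → rank (vertexAt i<n) ≡ i
  rank-vertexAt i<n = Finₚ.fromℕ<-injective _ _ _ _ (proj₂ (rank-surjective (fromℕ< i<n)))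

  vertexAt-< : ∀ {i j} (i<n : i < n) (j<n : j < n) → i < j → pos (vertexAt i<n) < pos (vertexAt j<n)
  vertexAt-< i<n j<n i<j = rank-<⁻¹ (subst₂ _<_ (sym (rank-vertexAt i<n)) (sym (rank-vertexAt j<n)) i<j)

-- Arcs on a line

greatestBelow : ∀ {P : Pred ℕ 0ℓ} → Decidable P → ∀ {x v} → x < v → P x →
                ∃[ y ] x ≤ y × y < v × P y × (∀ {z} → y < z → z < v → ¬ P z)
greatestBelow P? {x} {suc v} x<1+v Px with P? v
... | yes Pv = v , ≤-pred x<1+v , ≤-refl , Pv , λ v<z z<1+v → contradiction (≤-pred z<1+v) (<⇒≱ v<z)
... | no ¬Pv with m≤n⇒m<n∨m≡n (≤-pred x<1+v)
...   | inj₂ refl = contradiction Px ¬Pv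
...   | inj₁ x<v with greatestBelow P? x<v Px
...     | y , x≤y , y<v , Py , above = y , x≤y , m<n⇒m<1+n y<v , Py , above′
  where
  above′ : ∀ {z} → y < z → z < suc v → ¬ _
  above′ y<z z<1+v with m≤n⇒m<n∨m≡n (≤-pred z<1+v)
  ... | inj₁ z<v  = above y<z z<v
  ... | inj₂ refl = ¬Pv

module Arcs (Arc : ℕ → ℕ → Set) where

  NonCrossing : Set
  NonCrossing = ∀ {a b c d} → Arc a b → Arc c d → a < c → c < b → b < d → ⊥

  NonNesting : Set
  NonNesting = ∀ {a b c d} → Arc a b → Arc c d → a < c → d < b → ⊥

  Visible : ℕ → ℕ → ℕ → Set
  Visible u v y = u < y × y < v ×
    (∀ {a b} → Arc a b → u ≤ a → b ≤ v → a < y → y < b → (a , b) ≡ (u , v))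

  private
    covering-starts-at : NonCrossing → ∀ {u y a b} → y ≡ suc u ⊎ Arc u y →
                         Arc a b → u ≤ a → a < y → y < b → a ≡ u
    covering-starts-at _ (inj₁ refl) _ u≤a a<y _ = ≤-antisym (≤-pred a<y) u≤a
    covering-starts-at noCross (inj₂ Auy) Aab u≤a a<y y<b with m≤n⇒m<n∨m≡n u≤a
    ... | inj₁ u<a = ⊥-elim (noCross Auy Aab u<a a<y y<b)
    ... | inj₂ u≡a = sym u≡a

  visible-point : (∀ a b → Dec (Arc a b)) → NonCrossing → ∀ {u v} → 2 + u ≤ v → ∃ (Visible u v)
  visible-point Arc? noCross {u} {v} 2+u≤v
    with y , 1+u≤y , y<v , Py , above ← greatestBelow (λ b → (b ≟ suc u) ⊎-dec Arc? u b) 2+u≤v (inj₁ refl)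
    = y , 1+u≤y , y<v , only
    where
    only : ∀ {a b} → Arc a b → u ≤ a → b ≤ v → a < y → y < b → (a , b) ≡ (u , v)
    only Aab u≤a b≤v a<y y<b with refl ← covering-starts-at noCross Py Aab u≤a a<y y<b | m≤n⇒m<n∨m≡n b≤v
    ... | inj₂ refl = refl
    ... | inj₁ b<v  = contradiction (inj₂ Aab) (above y<b b<v)

  private
    visible-unique-≤ : NonCrossing → ∀ {u v u′ v′ y} → Arc u v → Arc u′ v′ → u ≤ u′ →
                       Visible u v y → Visible u′ v′ y → (u , v) ≡ (u′ , v′)
    visible-unique-≤ noCross {v = v} {v′ = v′} A A′ u≤u′ (u<y , y<v , onlyV) (u′<y , y<v′ , onlyV′)
      with v′ ≤? v
    ... | yes v′≤v = sym (onlyV A′ u≤u′ v′≤v u′<y y<v′)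
    ... | no v′≰v with m≤n⇒m<n∨m≡n u≤u′
    ...   | inj₁ u<u′ = ⊥-elim (noCross A A′ u<u′ (<-trans u′<y y<v) (≰⇒> v′≰v))
    ...   | inj₂ refl = onlyV′ A ≤-refl (<⇒≤ (≰⇒> v′≰v)) u<y y<v

  visible-unique : NonCrossing → ∀ {u v u′ v′ y} → Arc u v → Arc u′ v′ →
                   Visible u v y → Visible u′ v′ y → (u , v) ≡ (u′ , v′)
  visible-unique noCross {u} {v} {u′} {v′} A A′ V V′ with ≤-total u u′
  ... | inj₁ u≤u′ = visible-unique-≤ noCross A A′ u≤u′ V V′
  ... | inj₂ u′≤u = sym (visible-unique-≤ noCross A′ A u′≤u V′ V)

  sum-injective : NonNesting → ∀ {a b c d} → Arc a b → Arc c d → a + b ≡ c + d → (a , b) ≡ (c , d)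
  sum-injective noNest {a} {b} {c} {d} A A′ sum with <-cmp a c
  ... | tri< a<c _ _ = ⊥-elim (noNest A A′ a<c (≰⇒> λ b≤d → <⇒≢ (+-mono-<-≤ a<c b≤d) sum))
  ... | tri≈ _ refl _ = cong (a ,_) (+-cancelˡ-≡ a b d sum)
  ... | tri> _ _ c<a = ⊥-elim (noNest A′ A c<a (≰⇒> λ d≤b → <⇒≢ (+-mono-<-≤ c<a d≤b) (sym sum)))

-- Admissible pairs

++-injective : ∀ {A : Set} {m n} {xs : Vector A m} {ys : Vector A n} →
               Injective _≡_ _≡_ xs → Injective _≡_ _≡_ ys → (∀ i j → xs i ≢ ys j) →
               Injective _≡_ _≡_ (xs ++ ys)
++-injective {m = m} {n} {xs} {ys} xs-inj ys-inj disjoint {i} {j} eq =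
  Injection.injective (Inverse⇒Injection (Finₚ.+↔⊎ {m} {n})) ([,]-injective (splitAt m i) (splitAt m j) eq)
  where
  [,]-injective : ∀ x y → [ xs , ys ]′ x ≡ [ xs , ys ]′ y → x ≡ y
  [,]-injective (inj₁ x) (inj₁ y) eq = cong inj₁ (xs-inj eq)
  [,]-injective (inj₁ x) (inj₂ y) eq = contradiction eq (disjoint x y)
  [,]-injective (inj₂ x) (inj₁ y) eq = contradiction (sym eq) (disjoint y x)
  [,]-injective (inj₂ x) (inj₂ y) eq = cong inj₂ (ys-inj eq)

m<n∸1⇒2+m≤n : ∀ {m n} → m < n ∸ 1 → 2 + m ≤ n
m<n∸1⇒2+m≤n {n = suc n} m<n∸1 = s≤s m<n∸1

NonAdjacent : ℕ → ℕ × ℕ → Set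
NonAdjacent k (i , j) = 2 + i ≤ j × j < k

nonAdjacentCount : ℕ → ℕ
nonAdjacentCount zero    = 0
nonAdjacentCount (suc k) = nonAdjacentCount k + (k ∸ 1)

nonAdjacentPairs : ∀ k → Vector (ℕ × ℕ) (nonAdjacentCount k)
nonAdjacentPairs zero    = []
nonAdjacentPairs (suc k) = nonAdjacentPairs k ++ λ i → toℕ i , k

nonAdjacentPairs-nonAdjacent : ∀ k → All (NonAdjacent k) (nonAdjacentPairs k)
nonAdjacentPairs-nonAdjacent (suc k) = ++⁺ (NonAdjacent (suc k))
  (All.map {P = NonAdjacent k} (λ (gap , j<k) → gap , m<n⇒m<1+n j<k) (nonAdjacentPairs-nonAdjacent k))
  (λ i → m<n∸1⇒2+m≤n (Finₚ.toℕ<n i) , ≤-refl)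

nonAdjacentPairs-injective : ∀ k → Injective _≡_ _≡_ (nonAdjacentPairs k)
nonAdjacentPairs-injective (suc k) = ++-injective {xs = nonAdjacentPairs k}
  (nonAdjacentPairs-injective k)
  (Finₚ.toℕ-injective ∘ cong proj₁)
  (λ i j eq → <-irrefl (cong proj₂ eq) (proj₂ (nonAdjacentPairs-nonAdjacent k i)))

2*nonAdjacentCount : ∀ k → 2 * nonAdjacentCount (2 + k) ≡ (1 + k) * k
2*nonAdjacentCount zero    = refl
2*nonAdjacentCount (suc k) = begin
  2 * (nonAdjacentCount (2 + k) + suc k)   ≡⟨ *-distribˡ-+ 2 (nonAdjacentCount (2 + k)) (suc k) ⟩
  2 * nonAdjacentCount (2 + k) + 2 * suc k ≡⟨ cong (_+ 2 * suc k) (2*nonAdjacentCount k) ⟩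
  (1 + k) * k + 2 * suc k                  ≡⟨ expand k ⟩
  (2 + k) * (1 + k)                        ∎
  where
  open ≡-Reasoning
  expand : ∀ k → (1 + k) * k + 2 * suc k ≡ (2 + k) * (1 + k)
  expand = solve-∀

record Admissible (m a b : ℕ) : Set where
  field
    spaced : 2 + a ≤ b
    b<2m   : b < m + m
    m<a+b  : m < a + b
    a+b≤3m : a + b ≤ m + (m + m)

  a<b : a < b
  a<b = <-trans (n<1+n a) spaced

crossPair : ∀ {m} → Fin m × Fin (m ∸ 1) → ℕ × ℕ
crossPair {m} (x , c) = toℕ x , m + suc (toℕ c)

crossPair-admissible : ∀ {m} xc → uncurry (Admissible m) (crossPair xc)
crossPair-admissible {m} (x , c) = record
  { spaced = ≤-trans (s≤s x<m) (m<m+n m z<s)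
  ; b<2m   = b<2m
  ; m<a+b  = <-≤-trans (m<m+n m z<s) (m≤n+m _ (toℕ x))
  ; a+b≤3m = +-mono-≤ (<⇒≤ x<m) (<⇒≤ b<2m)
  }
  where
  x<m : toℕ x < m
  x<m = Finₚ.toℕ<n x
  b<2m : m + suc (toℕ c) < m + m
  b<2m = +-monoʳ-< m (m<n∸1⇒2+m≤n (Finₚ.toℕ<n c))

crossPair-injective : ∀ {m} → Injective _≡_ _≡_ (crossPair {m})
crossPair-injective {m} eq = cong₂ _,_
  (Finₚ.toℕ-injective (cong proj₁ eq))
  (Finₚ.toℕ-injective (suc-injective (+-cancelˡ-≡ m _ _ (cong proj₂ eq))))

raise : ℕ → ℕ × ℕ → ℕ × ℕ
raise m (i , j) with m <? i + j
... | yes _ = i , j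
... | no  _ = m + i , m + j

raise-admissible : ∀ {m} p → NonAdjacent m p → uncurry (Admissible m) (raise m p)
raise-admissible {m} (i , j) (gap , j<m) with m <? i + j
... | yes m<i+j = record
  { spaced = gap
  ; b<2m   = <-≤-trans j<m (m≤m+n m m)
  ; m<a+b  = m<i+j
  ; a+b≤3m = +-mono-≤ (<⇒≤ (<-trans (<-trans (n<1+n i) gap) j<m)) (≤-trans (<⇒≤ j<m) (m≤n+m m m))
  }
... | no m≮i+j = record
  { spaced = subst (λ t → suc t ≤ m + j) (+-suc m i) (+-monoʳ-< m gap)
  ; b<2m   = +-monoʳ-< m j<m
  ; m<a+b  = <-≤-trans (m<m+n m (<-≤-trans z<s gap)) (m≤n+m (m + j) (m + i))
  ; a+b≤3m = subst (_≤ m + (m + m)) (sym (shuffle m i j)) (+-monoʳ-≤ m (+-monoʳ-≤ m (≮⇒≥ m≮i+j)))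
  }
  where
  shuffle : ∀ m i j → (m + i) + (m + j) ≡ m + (m + (i + j))
  shuffle = solve-∀

raise-injective : ∀ {m p p′} → NonAdjacent m p → NonAdjacent m p′ →
                  raise m p ≡ raise m p′ → p ≡ p′
raise-injective {m} {i , j} {i′ , j′} (_ , j<m) (_ , j′<m) eq with m <? i + j | m <? i′ + j′
... | yes _ | yes _ = eq
... | yes _ | no  _ = contradiction (subst (m ≤_) (sym (cong proj₂ eq)) (m≤m+n m j′)) (<⇒≱ j<m)
... | no  _ | yes _ = contradiction (subst (m ≤_) (cong proj₂ eq) (m≤m+n m j)) (<⇒≱ j′<m)
... | no  _ | no  _ = cong₂ _,_ (+-cancelˡ-≡ m i i′ (cong proj₁ eq)) (+-cancelˡ-≡ m j j′ (cong proj₂ eq))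

raise-below-or-above : ∀ {m} p → NonAdjacent m p → proj₂ (raise m p) < m ⊎ m ≤ proj₁ (raise m p)
raise-below-or-above {m} (i , j) (_ , j<m) with m <? i + j
... | yes _ = inj₁ j<m
... | no  _ = inj₂ (m≤m+n m i)

crossPairs : ∀ m → Vector (ℕ × ℕ) (m * (m ∸ 1))
crossPairs m = crossPair ∘ Fin.remQuot {m} (m ∸ 1)

crossPairs-injective : ∀ m → Injective _≡_ _≡_ (crossPairs m)
crossPairs-injective m = Injection.injective (Inverse⇒Injection (Finₚ.*↔× {m} {m ∸ 1})) ∘ crossPair-injective

raisedPairs : ∀ m → Vector (ℕ × ℕ) (nonAdjacentCount m)
raisedPairs m = raise m ∘ nonAdjacentPairs m

admissibleCount : ℕ → ℕ
admissibleCount m = m * (m ∸ 1) + nonAdjacentCount m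

admissiblePairs : ∀ m → Vector (ℕ × ℕ) (admissibleCount m)
admissiblePairs m = crossPairs m ++ raisedPairs m

admissiblePairs-admissible : ∀ m → All (uncurry (Admissible m)) (admissiblePairs m)
admissiblePairs-admissible m = ++⁺ (uncurry (Admissible m))
  (crossPair-admissible ∘ Fin.remQuot {m} (m ∸ 1))
  (λ i → raise-admissible _ (nonAdjacentPairs-nonAdjacent m i))

admissiblePairs-injective : ∀ m → Injective _≡_ _≡_ (admissiblePairs m)
admissiblePairs-injective m = ++-injective {xs = crossPairs m} {ys = raisedPairs m}
  (crossPairs-injective m)
  (λ eq → nonAdjacentPairs-injective m (raise-injective (nonAdjacent _) (nonAdjacent _) eq))
  (λ i → cross≢raised (Fin.remQuot {m} (m ∸ 1) i))
  where
  nonAdjacent = nonAdjacentPairs-nonAdjacent m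

  cross≢raised : ∀ xc j → crossPair xc ≢ raisedPairs m j
  cross≢raised (x , c) j eq with raise-below-or-above _ (nonAdjacent j)
  ... | inj₁ b<m = <⇒≱ b<m (subst (m ≤_) (cong proj₂ eq) (m≤m+n m _))
  ... | inj₂ m≤a = <⇒≱ (Finₚ.toℕ<n x) (subst (m ≤_) (sym (cong proj₁ eq)) m≤a)

-- Arithmetic

2*admissibleCount : ∀ k → 2 * admissibleCount (2 + k) ≡ (1 + k) * (4 + 3 * k)
2*admissibleCount k = begin
  2 * ((2 + k) * (1 + k) + nonAdjacentCount (2 + k))
    ≡⟨ *-distribˡ-+ 2 ((2 + k) * (1 + k)) _ ⟩
  2 * ((2 + k) * (1 + k)) + 2 * nonAdjacentCount (2 + k)
    ≡⟨ cong (2 * ((2 + k) * (1 + k)) +_) (2*nonAdjacentCount k) ⟩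
  2 * ((2 + k) * (1 + k)) + (1 + k) * k
    ≡⟨ expand k ⟩
  (1 + k) * (4 + 3 * k)
    ∎
  where
  open ≡-Reasoning
  expand : ∀ k → 2 * ((2 + k) * (1 + k)) + (1 + k) * k ≡ (1 + k) * (4 + 3 * k)
  expand = solve-∀

admissibleCount≤⇒3k+1<4X : ∀ k X → admissibleCount (2 + k) ≤ X * ((2 + k) + (2 + k)) →
                            3 * k + 1 < 4 * X
admissibleCount≤⇒3k+1<4X k X count≤ = *-cancelʳ-< (2 + k) (3 * k + 1) (4 * X) (begin-strict
  (3 * k + 1) * (2 + k)          <⟨ subst ((3 * k + 1) * (2 + k) <_) (expand k) (m<m+n _ z<s) ⟩
  (1 + k) * (4 + 3 * k)          ≡⟨ 2*admissibleCount k ⟨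
  2 * admissibleCount (2 + k)    ≤⟨ *-monoʳ-≤ 2 count≤ ⟩
  2 * (X * ((2 + k) + (2 + k)))  ≡⟨ regroup X k ⟩
  4 * X * (2 + k)                ∎)
  where
  open ≤-Reasoning
  expand : ∀ k → (3 * k + 1) * (2 + k) + 2 ≡ (1 + k) * (4 + 3 * k)
  expand = solve-∀
  regroup : ∀ X k → 2 * (X * ((2 + k) + (2 + k))) ≡ 4 * X * (2 + k)
  regroup = solve-∀

admissibleCount≤⇒3[2m∸3]≤8X : ∀ m X → admissibleCount m ≤ X * (m + m) →
                              3 * (suc (m + m) ∸ 4) ≤ 8 * X
admissibleCount≤⇒3[2m∸3]≤8X zero          X _      = z≤n
admissibleCount≤⇒3[2m∸3]≤8X (suc zero)    X _      = z≤n
admissibleCount≤⇒3[2m∸3]≤8X (suc (suc k)) X count≤ = begin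
  3 * (suc ((2 + k) + (2 + k)) ∸ 4) ≡⟨ cong (λ t → 3 * (t ∸ 1)) (+-suc k (suc k)) ⟩
  3 * (k + suc k)                  ≤⟨ subst (3 * (k + suc k) ≤_) (regroup k) (n≤1+n _) ⟩
  2 * suc (3 * k + 1)              ≤⟨ *-monoʳ-≤ 2 (admissibleCount≤⇒3k+1<4X k X count≤) ⟩
  2 * (4 * X)                      ≡⟨ *-assoc 2 4 X ⟨
  8 * X                            ∎
  where
  open ≤-Reasoning
  regroup : ∀ k → suc (3 * (k + suc k)) ≡ 2 * suc (3 * k + 1)
  regroup = solve-∀

ceil3n-4/8-≤ : ∀ n X → 3 * (n ∸ 4) ≤ 8 * X → ceil3n-4/8 n ≤ X
ceil3n-4/8-≤ n X 3t≤8X =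
  ≤-pred (m<n*o⇒m/o<n (≤-trans (s≤s (+-monoˡ-≤ 7 3t≤8X)) (≤-reflexive (regroup X))))
  where
  regroup : ∀ X → suc (8 * X + 7) ≡ suc X * 8
  regroup = solve-∀

halve : ∀ n → ∃[ m ] m + m ≤ n × n ≤ suc (m + m)
halve zero          = 0 , z≤n , z≤n
halve (suc zero)    = 0 , z≤n , s≤s z≤n
halve (suc (suc n)) with m , 2m≤n , n≤2m+1 ← halve n =
  suc m , subst (_≤ 2 + n) (sym (cong suc (+-suc m m))) (s≤s (s≤s 2m≤n)) ,
  s≤s (s≤s (subst (n ≤_) (sym (+-suc m m)) n≤2m+1))

-- Layouts

module Layout {n s q} (L : MixedLayout n s q) where
  open MixedLayout L
  open VertexOrder order
  open Ranks order

  Page : Set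
  Page = Fin (s + q)

  edge : ∀ {a b} → a < b → b < n → Edge order
  edge a<b b<n = (vertexAt a<n , vertexAt b<n) , vertexAt-< a<n b<n a<b
    where a<n = <-trans a<b b<n

  OnPage : Page → ℕ → ℕ → Set
  OnPage p a b = Σ (a < b) λ a<b → Σ (b < n) λ b<n → page (edge a<b b<n) ≡ p

  onPage? : ∀ p a b → Dec (OnPage p a b)
  onPage? p a b with a <? b | b <? n
  ... | no a≮b  | _       = no (a≮b ∘ proj₁)
  ... | yes _   | no b≮n  = no (b≮n ∘ proj₁ ∘ proj₂)
  ... | yes a<b | yes b<n with page (edge a<b b<n) Finₚ.≟ p
  ...   | yes on  = yes (a<b , b<n , on)
  ...   | no  off = no λ (a<b′ , b<n′ , on) →
            off (subst₂ (λ x y → page (edge x y) ≡ p) (<-irrelevant a<b′ a<b) (<-irrelevant b<n′ b<n) on)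

  stack-nonCrossing : ∀ p → toℕ p < s → Arcs.NonCrossing (OnPage p)
  stack-nonCrossing p stack (a<b , b<n , on₁) (c<d , d<n , on₂) a<c c<b b<d =
    stack-ok (edge a<b b<n) (edge c<d d<n) (trans on₁ (sym on₂)) (subst (λ x → toℕ x < s) (sym on₁) stack)
      (inj₁ (vertexAt-< a<n c<n a<c , vertexAt-< c<n b<n c<b , vertexAt-< b<n d<n b<d))
    where a<n = <-trans a<b b<n; c<n = <-trans c<d d<n

  queue-nonNesting : ∀ p → s ≤ toℕ p → Arcs.NonNesting (OnPage p)
  queue-nonNesting p queue (a<b , b<n , on₁) (c<d , d<n , on₂) a<c d<b =
    queue-ok (edge a<b b<n) (edge c<d d<n) (trans on₁ (sym on₂)) (subst (λ x → s ≤ toℕ x) (sym on₁) queue)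
      (inj₁ (vertexAt-< a<n c<n a<c , vertexAt-< c<n d<n c<d , vertexAt-< d<n b<n d<b))
    where a<n = <-trans a<b b<n; c<n = <-trans c<d d<n

  module _ (m : ℕ) (2m≤n : m + m ≤ n) where
    open Admissible

    b<n : ∀ {a b} → Admissible m a b → b < n
    b<n A = <-≤-trans (b<2m A) 2m≤n

    pageOf : ∀ {a b} → Admissible m a b → Page
    pageOf A = page (edge (a<b A) (b<n A))

    onPageOf : ∀ {a b} (A : Admissible m a b) → OnPage (pageOf A) a b
    onPageOf A = a<b A , b<n A , refl

    visible : ∀ p → toℕ p < s → ∀ {a b} → Admissible m a b → ∃ (Arcs.Visible (OnPage p) a b)
    visible p stack A = Arcs.visible-point (OnPage p) (onPage? p) (stack-nonCrossing p stack) (spaced A)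

    slot : Page → ∀ {a b} → Admissible m a b → ℕ
    slot p {a} {b} A with toℕ p <? s
    ... | yes stack = proj₁ (visible p stack A)
    ... | no  _     = a + b ∸ suc m

    slot<2m : ∀ p {a b} (A : Admissible m a b) → slot p A < m + m
    slot<2m p {a} {b} A with toℕ p <? s
    ... | yes stack = <-trans (proj₁ (proj₂ (proj₂ (visible p stack A)))) (b<2m A)
    ... | no  _     = subst (a + b ∸ suc m <_) (m+n∸m≡n m (m + m)) (∸-monoˡ-< (s≤s (a+b≤3m A)) (m<a+b A))

    slot-injective : ∀ {p p′} → p ≡ p′ → ∀ {a b c d} (A : Admissible m a b) (C : Admissible m c d) →
                     OnPage p a b → OnPage p′ c d → slot p A ≡ slot p′ C → (a , b) ≡ (c , d)
    slot-injective {p} refl A C onA onC same with toℕ p <? s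
    ... | yes stack = Arcs.visible-unique (OnPage p) (stack-nonCrossing p stack) onA onC
          (proj₂ (visible p stack A)) (subst (Arcs.Visible (OnPage p) _ _) (sym same) (proj₂ (visible p stack C)))
    ... | no ¬stack = Arcs.sum-injective (OnPage p) (queue-nonNesting p (≮⇒≥ ¬stack)) onA onC
          (∸-cancelʳ-≡ (m<a+b A) (m<a+b C) same)

    key : Fin (admissibleCount m) → Fin ((s + q) * (m + m))
    key i = Fin.combine (pageOf A) (fromℕ< (slot<2m (pageOf A) A))
      where A = admissiblePairs-admissible m i

    key-injective : Injective _≡_ _≡_ key
    key-injective {i} {j} same with Finₚ.combine-injective _ _ _ _ same
    ... | samePage , sameSlot = admissiblePairs-injective m
          (slot-injective samePage A B (onPageOf A) (onPageOf B) (Finₚ.fromℕ<-injective _ _ _ _ sameSlot))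
      where
      A = admissiblePairs-admissible m i
      B = admissiblePairs-admissible m j

lemma1 : ∀ (n s q : ℕ) → MixedLayout n s q → ceil3n-4/8 n ≤ s + q
lemma1 n s q L with m , 2m≤n , n≤2m+1 ← halve n = ceil3n-4/8-≤ n (s + q) (begin
  3 * (n ∸ 4)                ≤⟨ *-monoʳ-≤ 3 (∸-monoˡ-≤ 4 n≤2m+1) ⟩
  3 * (suc (m + m) ∸ 4)      ≤⟨ admissibleCount≤⇒3[2m∸3]≤8X m (s + q) admissibleCount≤ ⟩
  8 * (s + q)                ∎)
  where
  open ≤-Reasoning
  admissibleCount≤ : admissibleCount m ≤ (s + q) * (m + m)
  admissibleCount≤ = Finₚ.injective⇒≤ (Layout.key-injective L m 2m≤n)
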